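{- (Completeness of access Hoare logic.) For every program $C$ of the while language and all assertions $P,Q$: if $\langle P\rangle\,C\,\langle Q\rangle$ is valid, then $\langle P\rangle\,C\,\langle Q\rangle$ is provable in access Hoare logic.
   Context: States are mappings from variables to values; assertions are arbitrary predicates on states. Programs of the while language are built from $\mathtt{skip}$, assignments $V:=E$ ($V$ a variable, $E$ a side-effect-free expression possibly containing $V$), sequential composition $S;T$, $\mathtt{if}\ B\ \mathtt{then}\ S\ \mathtt{else}\ T$ and $\mathtt{while}\ B\ \mathtt{do}\ S$ ($B$ a boolean condition), with the standard deterministic big-step execution relation $C:s\Rightarrow s'$. The access Hoare triple $\langle P\rangle\,C\,\langle Q\rangle$ is valid iff $\forall s,s'\,[\,C:s\Rightarrow s'\wedge Q(s')\rightarrow P(s)\,]$. Access Hoare logic is the calculus with the following axioms and rules: (skip) $\langle P\rangle\,\mathtt{skip}\,\langle P\rangle$; (assignment) $\langle P[E/V]\rangle\,V:=E\,\langle P\rangle$, where $P[E/V]$ replaces free occurrences of $V$ in $P$ by $E$; (consequence) from $P_2\rightarrow P_1$ (valid implication), $\langle P_2\rangle\,S\,\langle Q_2\rangle$ and $Q_1\rightarrow Q_2$ (valid implication) infer $\langle P_1\rangle\,S\,\langle Q_1\rangle$; (composition) from $\langle P\rangle\,S\,\langle R\rangle$ and $\langle R\rangle\,T\,\langle Q\rangle$ infer $\langle P\rangle\,S;T\,\langle Q\rangle$; (conditional) from $\langle B\rightarrow P\rangle\,S\,\langle Q\rangle$ and $\langle \neg B\rightarrow P\rangle\,T\,\langle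 Q\rangle$ infer $\langle P\rangle\,\mathtt{if}\ B\ \mathtt{then}\ S\ \mathtt{else}\ T\,\langle Q\rangle$; (while) from $\langle B\rightarrow P\rangle\,S\,\langle P\rangle$ infer $\langle P\rangle\,\mathtt{while}\ B\ \mathtt{do}\ S\,\langle \neg B\rightarrow P\rangle$. -}

module Defs where

open import Data.Nat using (ℕ; _≟_)
import Data.Bool
open import Data.Bool using (Bool; true; false; T)
open import Relation.Nullary using (¬_; yes; no)

Var : Set
Var = ℕ

Val : Set
Val = ℕ

State : Set
State = Var → Val

Exp : Set
Exp = State → Val

BExp : Set
BExp = State → Bool

Assn : Set₁
Assn = State → Set

_[_↦_] : State → Var → Val → State
(s [ x ↦ v ]) y with y ≟ x
... | yes _ = v
... | no  _ = s y

data Cmd : Set where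
  skip   : Cmd
  _:=_   : Var → Exp → Cmd
  _︔_    : Cmd → Cmd → Cmd
  if_then_else_ : BExp → Cmd → Cmd → Cmd
  while_loop_ : BExp → Cmd → Cmd

data _∶_⇒_ : Cmd → State → State → Set where
  E-skip   : ∀ {s} → skip ∶ s ⇒ s
  E-assign : ∀ {s x e} → (x := e) ∶ s ⇒ (s [ x ↦ e s ])
  E-seq    : ∀ {S T s s' s''} → S ∶ s ⇒ s' → T ∶ s' ⇒ s'' → (S ︔ T) ∶ s ⇒ s''
  E-ifT    : ∀ {b S T s s'} → Data.Bool.T (b s) → S ∶ s ⇒ s' → (if b then S else T) ∶ s ⇒ s'
  E-ifF    : ∀ {b S T s s'} → ¬ Data.Bool.T (b s) → T ∶ s ⇒ s' → (if b then S else T) ∶ s ⇒ s'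
  E-whileF : ∀ {b S s} → ¬ Data.Bool.T (b s) → (while b loop S) ∶ s ⇒ s
  E-whileT : ∀ {b S s s' s''} → Data.Bool.T (b s) → S ∶ s ⇒ s' → (while b loop S) ∶ s' ⇒ s''
             → (while b loop S) ∶ s ⇒ s''

_⇒ₐ_ : Assn → Assn → Assn
(P ⇒ₐ Q) s = P s → Q s

¬ₐ : BExp → Assn
¬ₐ b s = ¬ T (b s)

bₐ : BExp → Assn
bₐ b s = T (b s)

_⊨→_ : Assn → Assn → Set
P ⊨→ Q = ∀ s → P s → Q s

_[_/_] : Assn → Exp → Var → Assn
(P [ e / x ]) s = P (s [ x ↦ e s ])

⊨⟨_⟩_⟨_⟩ : Assn → Cmd → Assn → Set
⊨⟨ P ⟩ C ⟨ Q ⟩ = ∀ s s' → C ∶ s ⇒ s' → Q s' → P s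

data ⊢⟨_⟩_⟨_⟩ : Assn → Cmd → Assn → Set₁ where
  H-skip   : ∀ {P} → ⊢⟨ P ⟩ skip ⟨ P ⟩
  H-assign : ∀ {P x e} → ⊢⟨ P [ e / x ] ⟩ (x := e) ⟨ P ⟩
  H-conseq : ∀ {P₁ P₂ Q₁ Q₂ S} → P₂ ⊨→ P₁ → ⊢⟨ P₂ ⟩ S ⟨ Q₂ ⟩ → Q₁ ⊨→ Q₂
             → ⊢⟨ P₁ ⟩ S ⟨ Q₁ ⟩
  H-seq    : ∀ {P R Q S T} → ⊢⟨ P ⟩ S ⟨ R ⟩ → ⊢⟨ R ⟩ T ⟨ Q ⟩ → ⊢⟨ P ⟩ (S ︔ T) ⟨ Q ⟩
  H-if     : ∀ {P Q b S T} → ⊢⟨ bₐ b ⇒ₐ P ⟩ S ⟨ Q ⟩ → ⊢⟨ ¬ₐ b ⇒ₐ P ⟩ T ⟨ Q ⟩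
             → ⊢⟨ P ⟩ (if b then S else T) ⟨ Q ⟩
  H-while  : ∀ {P b S} → ⊢⟨ bₐ b ⇒ₐ P ⟩ S ⟨ P ⟩ → ⊢⟨ P ⟩ (while b loop S) ⟨ ¬ₐ b ⇒ₐ P ⟩

-- A triple ⟨P⟩ C ⟨Q⟩ is valid exactly when P contains the set pre C Q of
-- states from which some run of C ends in Q.  So it suffices to derive
-- ⟨pre C Q⟩ C ⟨Q⟩ for every C and Q and to strengthen the precondition by
-- consequence.  That derivation is by structural induction on C; for a loop,
-- pre (while b loop S) Q is itself the invariant.
module Submission where

open import Defs
open import Data.Product using (Σ-syntax; _×_; _,_)

pre : Cmd → Assn → Assn
pre C Q s = Σ[ s' ∈ State ] (C ∶ s ⇒ s') × Q s'

⊨→-refl : ∀ {P} → P ⊨→ P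
⊨→-refl _ p = p

valid⇒pre⊨→ : ∀ {P C Q} → ⊨⟨ P ⟩ C ⟨ Q ⟩ → pre C Q ⊨→ P
valid⇒pre⊨→ v s (s' , run , q) = v s s' run q

⊢-pre : ∀ C Q → ⊢⟨ pre C Q ⟩ C ⟨ Q ⟩
⊢-pre skip Q = H-conseq (λ s q → s , E-skip , q) H-skip ⊨→-refl
⊢-pre (x := e) Q = H-conseq (λ s q → _ , E-assign , q) H-assign ⊨→-refl
⊢-pre (S ︔ T) Q = H-seq (H-conseq seq-pre (⊢-pre S (pre T Q)) ⊨→-refl) (⊢-pre T Q)
  where
  seq-pre : pre S (pre T Q) ⊨→ pre (S ︔ T) Q
  seq-pre s (s' , runS , s'' , runT , q) = s'' , E-seq runS runT , q
⊢-pre (if b then S else T) Q =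
  H-if (H-conseq then-pre (⊢-pre S Q) ⊨→-refl)
       (H-conseq else-pre (⊢-pre T Q) ⊨→-refl)
  where
  then-pre : pre S Q ⊨→ (bₐ b ⇒ₐ pre (if b then S else T) Q)
  then-pre s (s' , run , q) b-true = s' , E-ifT b-true run , q

  else-pre : pre T Q ⊨→ (¬ₐ b ⇒ₐ pre (if b then S else T) Q)
  else-pre s (s' , run , q) b-false = s' , E-ifF b-false run , q
⊢-pre (while b loop S) Q =
  H-conseq ⊨→-refl (H-while (H-conseq body-pre (⊢-pre S I) ⊨→-refl)) exit-pre
  where
  I : Assn
  I = pre (while b loop S) Q

  body-pre : pre S I ⊨→ (bₐ b ⇒ₐ I)
  body-pre s (s' , runS , s'' , runW , q) b-true = s'' , E-whileT b-true runS runW , q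

  exit-pre : Q ⊨→ (¬ₐ b ⇒ₐ I)
  exit-pre s q b-false = s , E-whileF b-false , q

theorem6p2 : (C : Cmd) (P Q : Assn) → ⊨⟨ P ⟩ C ⟨ Q ⟩ → ⊢⟨ P ⟩ C ⟨ Q ⟩
theorem6p2 C P Q valid = H-conseq (valid⇒pre⊨→ valid) (⊢-pre C Q) ⊨→-refl
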